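{- Fix a positive integer $k$ and define the sequence $(a_k(n))_{n\ge0}$ by $a_k(0)=1$ and \[ a_k(n+1) = \sum_{\substack{0\le i\le n\\ k\mid i}} a_k(i)\,a_k(n-i)\qquad (n\ge0). \] Then, writing $n=km+j$ with integers $m\ge0$ and $0\le j<k$, \[ a_k(km+j) = \frac{j+1}{km+j+1}\binom{(k+1)m+j}{km+j}. \] In particular $a_k(km+j)=A_m(k+1,j+1)$ and $a_k(km)=C_m^{k+1}$.
   Context: The Raney numbers are $A_m(p,r)=\frac{r}{mp+r}\binom{mp+r}{m}$, and the Fuss--Catalan numbers are $C_n^p=\frac{1}{pn+1}\binom{pn+1}{n}=\frac{1}{(p-1)n+1}\binom{pn}{n}$. -}

module Defs where

open import Data.Nat using (ℕ; zero; suc; _+_; _*_; _∸_)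
open import Data.Nat.Divisibility using (_∣?_)
open import Data.Fin using (Fin; zero; suc; toℕ; opposite)
open import Data.Vec using (Vec; _∷_; lookup; head)
open import Relation.Nullary using (yes; no)

sumFin : (n : ℕ) → (Fin (suc n) → ℕ) → ℕ
sumFin zero    f = f zero
sumFin (suc n) f = f zero + sumFin n (λ j → f (suc j))

-- hist k n = [ a_k(n) , a_k(n-1) , … , a_k(0) ]   (so  lookup (hist k n) j = a_k(n - j))
-- course-of-values computation of
--   a_k(0) = 1,   a_k(n+1) = Σ_{0 ≤ i ≤ n, k ∣ i} a_k(i) · a_k(n - i).
-- In the step, the summation index is j = n - i (j ranges over 0..n as i does),
-- the term is a_k(n-j) · a_k(j) with condition k ∣ (n - j).
hist : ℕ → (n : ℕ) → Vec ℕ (suc n)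
hist k zero    = 1 ∷ Data.Vec.[]
hist k (suc n) = step ∷ r
  where
  r : Vec ℕ (suc n)
  r = hist k n
  term : Fin (suc n) → ℕ
  term j with k ∣? (n ∸ toℕ j)
  ... | yes _ = lookup r j * lookup r (opposite j)
  ... | no  _ = 0
  step : ℕ
  step = sumFin n term

a : ℕ → ℕ → ℕ
a k n = head (hist k n)

{-# OPTIONS --safe #-}
module Submission where

-- Writing n = j + m·k with j < k, only the summands with i = l·k survive in the recurrence, so
-- a_k(km + j + 1) = Σ_{l ≤ m} a_k(lk)·a_k(k(m − l) + j). By strong induction on n this is the
-- convolution identity A_m(p, r + 1) = Σ_l A_l(p, 1)·A_(m−l)(p, r) of the Raney numbers with p = k + 1,
-- hence a_k(km + j) = A_m(k + 1, j + 1). The closed form of A_m(p, r) then follows from its recurrence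
-- and Pascal's rule through the additive formula A_(m+1)(p, r) = C(N, m + 1) − (p − 1)·C(N, m).

open import Defs
open import Data.Bool using (if_then_else_)
open import Data.Fin using (Fin; zero; suc; toℕ; opposite)
open import Data.Fin.Properties using (opposite-prop)
open import Data.Nat using (ℕ; zero; suc; _+_; _*_; _∸_; _≤_; _<_; z≤n; s≤s; z<s; NonZero)
open import Data.Nat.Combinatorics using (_C_; nCk≡nC[n∸k]; nC1≡n; nCk+nC[k+1]≡[n+1]C[k+1])
open import Data.Nat.Divisibility using (_∣_; _∤_; _∣?_; _∣0; >⇒∤; ∣m+n∣m⇒∣n; n∣m*n)
open import Data.Nat.Induction using (<-rec)
open import Data.Nat.Properties
open import Data.Nat.Tactic.RingSolver using (solve-∀)
open import Data.Vec using (lookup)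
open import Function using (_∘_)
open import Relation.Binary.PropositionalEquality
open import Relation.Nullary.Decidable using (does; yes; no; dec-true; dec-false)
open import Algebra.Properties.CommutativeSemigroup +-commutativeSemigroup using (interchange; xy∙z≈xz∙y)
open import Algebra.Properties.CommutativeSemigroup *-commutativeSemigroup using ()
  renaming (xy∙z≈y∙xz to *-xy∙z≈y∙xz; x∙yz≈y∙xz to *-x∙yz≈y∙xz)
open ≡-Reasoning

sumTo : ℕ → (ℕ → ℕ) → ℕ
sumTo zero    f = f 0
sumTo (suc n) f = f 0 + sumTo n (f ∘ suc)

sumTo-suc : ∀ n f → sumTo (suc n) f ≡ sumTo n f + f (suc n)
sumTo-suc zero    f = refl
sumTo-suc (suc n) f = begin
  f 0 + sumTo (suc n) (f ∘ suc)        ≡⟨ cong (f 0 +_) (sumTo-suc n (f ∘ suc)) ⟩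
  f 0 + (sumTo n (f ∘ suc) + f (2 + n)) ≡⟨ +-assoc (f 0) _ _ ⟨
  f 0 + sumTo n (f ∘ suc) + f (2 + n)   ∎

sumTo-cong : ∀ n {f g} → (∀ {i} → i ≤ n → f i ≡ g i) → sumTo n f ≡ sumTo n g
sumTo-cong zero    f≗g = f≗g z≤n
sumTo-cong (suc n) f≗g = cong₂ _+_ (f≗g z≤n) (sumTo-cong n (f≗g ∘ s≤s))

sumTo-distrib-+ : ∀ n f g → sumTo n (λ i → f i + g i) ≡ sumTo n f + sumTo n g
sumTo-distrib-+ zero    f g = refl
sumTo-distrib-+ (suc n) f g = begin
  f 0 + g 0 + sumTo n (λ i → f (suc i) + g (suc i))
    ≡⟨ cong (f 0 + g 0 +_) (sumTo-distrib-+ n (f ∘ suc) (g ∘ suc)) ⟩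
  f 0 + g 0 + (sumTo n (f ∘ suc) + sumTo n (g ∘ suc))
    ≡⟨ interchange (f 0) (g 0) _ _ ⟩
  f 0 + sumTo n (f ∘ suc) + (g 0 + sumTo n (g ∘ suc)) ∎

sumTo-distribʳ-* : ∀ n f c → sumTo n (λ i → f i * c) ≡ sumTo n f * c
sumTo-distribʳ-* zero    f c = refl
sumTo-distribʳ-* (suc n) f c = begin
  f 0 * c + sumTo n (λ i → f (suc i) * c) ≡⟨ cong (f 0 * c +_) (sumTo-distribʳ-* n (f ∘ suc) c) ⟩
  f 0 * c + sumTo n (f ∘ suc) * c         ≡⟨ *-distribʳ-+ c (f 0) _ ⟨
  (f 0 + sumTo n (f ∘ suc)) * c           ∎

sumTo-reverse : ∀ n f → sumTo n f ≡ sumTo n (λ i → f (n ∸ i))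
sumTo-reverse zero    f = refl
sumTo-reverse (suc n) f = begin
  f 0 + sumTo n (f ∘ suc)
    ≡⟨ cong (f 0 +_) (sumTo-reverse n (f ∘ suc)) ⟩
  f 0 + sumTo n (λ i → f (suc (n ∸ i)))
    ≡⟨ +-comm (f 0) _ ⟩
  sumTo n (λ i → f (suc (n ∸ i))) + f 0
    ≡⟨ cong₂ _+_ (sumTo-cong n (cong f ∘ sym ∘ +-∸-assoc 1)) (cong f (sym (n∸n≡0 n))) ⟩
  sumTo n (λ i → f (suc n ∸ i)) + f (suc n ∸ suc n)
    ≡⟨ sumTo-suc n (λ i → f (suc n ∸ i)) ⟨
  sumTo (suc n) (λ i → f (suc n ∸ i))
    ∎

restrictToMultiples : ℕ → (ℕ → ℕ) → ℕ → ℕ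
restrictToMultiples k h i = if does (k ∣? i) then h i else 0

restrictToMultiples-∣ : ∀ {k i} h → k ∣ i → restrictToMultiples k h i ≡ h i
restrictToMultiples-∣ {k} {i} h k∣i = cong (λ b → if b then h i else 0) (dec-true (k ∣? i) k∣i)

restrictToMultiples-∤ : ∀ {k i} h → k ∤ i → restrictToMultiples k h i ≡ 0
restrictToMultiples-∤ {k} {i} h k∤i = cong (λ b → if b then h i else 0) (dec-false (k ∣? i) k∤i)

sumTo-restrictToMultiples-offset : ∀ k h m j → j < suc k →
  sumTo (j + m * suc k) (restrictToMultiples (suc k) h) ≡ sumTo (m * suc k) (restrictToMultiples (suc k) h)
sumTo-restrictToMultiples-offset k h m zero    _       = refl
sumTo-restrictToMultiples-offset k h m (suc j) 1+j<1+k = begin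
  sumTo (suc j + m * suc k) H
    ≡⟨ sumTo-suc (j + m * suc k) H ⟩
  sumTo (j + m * suc k) H + H (suc j + m * suc k)
    ≡⟨ cong (sumTo (j + m * suc k) H +_) (restrictToMultiples-∤ h ∤) ⟩
  sumTo (j + m * suc k) H + 0
    ≡⟨ +-identityʳ _ ⟩
  sumTo (j + m * suc k) H
    ≡⟨ sumTo-restrictToMultiples-offset k h m j (<-trans (n<1+n j) 1+j<1+k) ⟩
  sumTo (m * suc k) H
    ∎
  where
  H = restrictToMultiples (suc k) h
  ∤ : suc k ∤ suc j + m * suc k
  ∤ k∣ = >⇒∤ 1+j<1+k (∣m+n∣m⇒∣n (subst (suc k ∣_) (+-comm (suc j) (m * suc k)) k∣) (n∣m*n m))

sumTo-restrictToMultiples : ∀ k h m → sumTo (m * suc k) (restrictToMultiples (suc k) h) ≡ sumTo m (λ l → h (l * suc k))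
sumTo-restrictToMultiples k h zero    = restrictToMultiples-∣ h (suc k ∣0)
sumTo-restrictToMultiples k h (suc m) = begin
  sumTo (suc m * suc k) H
    ≡⟨ sumTo-suc (k + m * suc k) H ⟩
  sumTo (k + m * suc k) H + H (suc m * suc k)
    ≡⟨ cong₂ _+_ previous (restrictToMultiples-∣ h (n∣m*n (suc m))) ⟩
  sumTo m (λ l → h (l * suc k)) + h (suc m * suc k)
    ≡⟨ sumTo-suc m (λ l → h (l * suc k)) ⟨
  sumTo (suc m) (λ l → h (l * suc k))
    ∎
  where
  H = restrictToMultiples (suc k) h
  previous : sumTo (k + m * suc k) H ≡ sumTo m (λ l → h (l * suc k))
  previous = trans (sumTo-restrictToMultiples-offset k h m k ≤-refl) (sumTo-restrictToMultiples k h m)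

_⊛_ : (ℕ → ℕ) → (ℕ → ℕ) → ℕ → ℕ
(f ⊛ g) n = sumTo n (λ i → f i * g (n ∸ i))

⊛-suc : ∀ f g n → (f ⊛ g) (suc n) ≡ (f ⊛ (g ∘ suc)) n + f (suc n) * g 0
⊛-suc f g n = begin
  (f ⊛ g) (suc n)
    ≡⟨ sumTo-suc n _ ⟩
  sumTo n (λ i → f i * g (suc n ∸ i)) + f (suc n) * g (n ∸ n)
    ≡⟨ cong₂ _+_ (sumTo-cong n shift) (cong (λ i → f (suc n) * g i) (n∸n≡0 n)) ⟩
  (f ⊛ (g ∘ suc)) n + f (suc n) * g 0
    ∎
  where
  shift : ∀ {i} → i ≤ n → f i * g (suc n ∸ i) ≡ f i * g (suc (n ∸ i))
  shift {i} i≤n = cong (λ l → f i * g l) (+-∸-assoc 1 i≤n)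

⊛-distribˡ-+ : ∀ f g h n → (f ⊛ (λ i → g i + h i)) n ≡ (f ⊛ g) n + (f ⊛ h) n
⊛-distribˡ-+ f g h n = begin
  sumTo n (λ i → f i * (g (n ∸ i) + h (n ∸ i)))     ≡⟨ sumTo-cong n (λ {i} _ → *-distribˡ-+ (f i) _ _) ⟩
  sumTo n (λ i → f i * g (n ∸ i) + f i * h (n ∸ i)) ≡⟨ sumTo-distrib-+ n _ _ ⟩
  (f ⊛ g) n + (f ⊛ h) n                              ∎

⊛-zeroʳ : ∀ f n → (f ⊛ (λ _ → 0)) n ≡ 0
⊛-zeroʳ f n = trans (sumTo-distribʳ-* n f 0) (*-zeroʳ (sumTo n f))

-- raney p r m is the Raney number A_m(p,r). The recurrence is the coefficient form of
-- B^(r+1) = B^r + x·B^(r+p), where B = 1 + x·B^p and A_m(p,r) = [x^m] B^r.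
raney : ℕ → ℕ → ℕ → ℕ
raney p r       zero    = 1
raney p zero    (suc m) = 0
raney p (suc r) (suc m) = raney p r (suc m) + raney p (r + p) m

raney-conv : ∀ p r m → (raney p 1 ⊛ raney p r) m ≡ raney p (suc r) m
raney-conv p r       zero    = refl
raney-conv p zero    (suc m) = begin
  (raney p 1 ⊛ raney p 0) (suc m)                   ≡⟨ ⊛-suc (raney p 1) (raney p 0) m ⟩
  (raney p 1 ⊛ (λ _ → 0)) m + raney p 1 (suc m) * 1 ≡⟨ cong₂ _+_ (⊛-zeroʳ (raney p 1) m) (*-identityʳ _) ⟩
  raney p 1 (suc m)                                 ∎
raney-conv p (suc r) (suc m) = begin
  (R₁ ⊛ raney p (suc r)) (suc m)
    ≡⟨ ⊛-suc R₁ (raney p (suc r)) m ⟩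
  (R₁ ⊛ (λ i → raney p r (suc i) + raney p (r + p) i)) m + R₁ (suc m) * 1
    ≡⟨ cong (_+ R₁ (suc m) * 1) (⊛-distribˡ-+ R₁ (raney p r ∘ suc) (raney p (r + p)) m) ⟩
  (R₁ ⊛ (raney p r ∘ suc)) m + (R₁ ⊛ raney p (r + p)) m + R₁ (suc m) * 1
    ≡⟨ cong (λ x → (R₁ ⊛ (raney p r ∘ suc)) m + x + R₁ (suc m) * 1) (raney-conv p (r + p) m) ⟩
  (R₁ ⊛ (raney p r ∘ suc)) m + raney p (suc r + p) m + R₁ (suc m) * 1
    ≡⟨ xy∙z≈xz∙y ((R₁ ⊛ (raney p r ∘ suc)) m) (raney p (suc r + p) m) (R₁ (suc m) * 1) ⟩
  (R₁ ⊛ (raney p r ∘ suc)) m + R₁ (suc m) * 1 + raney p (suc r + p) m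
    ≡⟨ cong (_+ raney p (suc r + p) m) (⊛-suc R₁ (raney p r) m) ⟨
  (R₁ ⊛ raney p r) (suc m) + raney p (suc r + p) m
    ≡⟨ cong (_+ raney p (suc r + p) m) (raney-conv p r (suc m)) ⟩
  raney p (2 + r) (suc m)
    ∎
  where
  R₁ = raney p 1

[k+1]*nC[k+1]+k*nCk≡n*nCk : ∀ n k → suc k * (n C suc k) + k * (n C k) ≡ n * (n C k)
[k+1]*nC[k+1]+k*nCk≡n*nCk zero    zero    = refl
[k+1]*nC[k+1]+k*nCk≡n*nCk zero    (suc k) = cong₂ _+_ (*-zeroʳ (2 + k)) (*-zeroʳ (suc k))
[k+1]*nC[k+1]+k*nCk≡n*nCk (suc n) zero    = begin
  1 * (suc n C 1) + 0 ≡⟨ cong (λ c → 1 * c + 0) (nC1≡n (suc n)) ⟩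
  1 * suc n + 0       ≡⟨ +-identityʳ (1 * suc n) ⟩
  1 * suc n           ≡⟨ *-comm 1 (suc n) ⟩
  suc n * 1           ∎
[k+1]*nC[k+1]+k*nCk≡n*nCk (suc n) (suc k) = begin
  (2 + k) * (suc n C (2 + k)) + suc k * (suc n C suc k)
    ≡⟨ cong₂ (λ x y → (2 + k) * x + suc k * y) (pascal n (suc k)) (pascal n k) ⟨
  (2 + k) * (c₁ + c₂) + suc k * (c₀ + c₁)
    ≡⟨ regroup k c₀ c₁ c₂ ⟩
  ((2 + k) * c₂ + suc k * c₁) + (suc k * c₁ + k * c₀) + (c₀ + c₁)
    ≡⟨ cong₂ (λ x y → x + y + (c₀ + c₁)) ([k+1]*nC[k+1]+k*nCk≡n*nCk n (suc k)) ([k+1]*nC[k+1]+k*nCk≡n*nCk n k) ⟩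
  n * c₁ + n * c₀ + (c₀ + c₁)
    ≡⟨ collect n c₀ c₁ ⟩
  suc n * (c₀ + c₁)
    ≡⟨ cong (suc n *_) (pascal n k) ⟩
  suc n * (suc n C suc k)
    ∎
  where
  pascal = nCk+nC[k+1]≡[n+1]C[k+1]
  c₀ = n C k
  c₁ = n C suc k
  c₂ = n C (2 + k)
  regroup : ∀ k c₀ c₁ c₂ → (2 + k) * (c₁ + c₂) + suc k * (c₀ + c₁)
                           ≡ ((2 + k) * c₂ + suc k * c₁) + (suc k * c₁ + k * c₀) + (c₀ + c₁)
  regroup = solve-∀
  collect : ∀ n c₀ c₁ → n * c₁ + n * c₀ + (c₀ + c₁) ≡ suc n * (c₀ + c₁)
  collect = solve-∀

[k+1]*[n+k]C[k+1]≡n*[n+k]Ck : ∀ n k → suc k * ((n + k) C suc k) ≡ n * ((n + k) C k)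
[k+1]*[n+k]C[k+1]≡n*[n+k]Ck n k = +-cancelʳ-≡ (k * c₀) _ _ (begin
  suc k * ((n + k) C suc k) + k * c₀ ≡⟨ [k+1]*nC[k+1]+k*nCk≡n*nCk (n + k) k ⟩
  (n + k) * c₀                        ≡⟨ *-distribʳ-+ c₀ n k ⟩
  n * c₀ + k * c₀                     ∎)
  where
  c₀ = (n + k) C k

[m+n]Cn≡[m+n]Cm : ∀ m n → (m + n) C n ≡ (m + n) C m
[m+n]Cn≡[m+n]Cm m n = trans (nCk≡nC[n∸k] (m≤n+m n m)) (cong ((m + n) C_) (m+n∸n≡m m n))

-- Additive form of A_(m+1)(p,r) = C(N,m+1) − (p−1)·C(N,m) with p = q+1 and N = (m+1)p + r − 1.
raney-binomial : ∀ q r m → raney (suc q) r (suc m) + q * ((r + suc m * q + m) C m) ≡ (r + suc m * q + m) C suc m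
raney-binomial q zero m = sym (*-cancelˡ-≡ c₁ (q * c₀) (suc m) (begin
  suc m * c₁       ≡⟨ [k+1]*[n+k]C[k+1]≡n*[n+k]Ck (suc m * q) m ⟩
  suc m * q * c₀   ≡⟨ *-assoc (suc m) q c₀ ⟩
  suc m * (q * c₀) ∎))
  where
  c₀ = (suc m * q + m) C m
  c₁ = (suc m * q + m) C suc m
raney-binomial q (suc r) zero = begin
  raney (suc q) r 1 + 1 + q * 1   ≡⟨ xy∙z≈xz∙y (raney (suc q) r 1) 1 (q * 1) ⟩
  raney (suc q) r 1 + q * 1 + 1   ≡⟨ +-comm _ 1 ⟩
  1 + (raney (suc q) r 1 + q * 1) ≡⟨ cong (1 +_) (raney-binomial q r zero) ⟩
  1 + (N C 1)                      ≡⟨ nCk+nC[k+1]≡[n+1]C[k+1] N 0 ⟩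
  suc N C 1                        ∎
  where
  N = r + 1 * q + 0
raney-binomial q (suc r) (suc m) = begin
  raney (suc q) r (2 + m) + raney (suc q) (r + suc q) (suc m) + q * (suc N C suc m)
    ≡⟨ cong (λ c → raney (suc q) r (2 + m) + raney (suc q) (r + suc q) (suc m) + q * c) (pascal N m) ⟨
  raney (suc q) r (2 + m) + raney (suc q) (r + suc q) (suc m) + q * (N C m + N C suc m)
    ≡⟨ regroup (raney (suc q) r (2 + m)) (raney (suc q) (r + suc q) (suc m)) q (N C m) (N C suc m) ⟩
  (raney (suc q) r (2 + m) + q * (N C suc m)) + (raney (suc q) (r + suc q) (suc m) + q * (N C m))
    ≡⟨ cong₂ _+_ (raney-binomial q r (suc m)) shifted ⟩
  N C (2 + m) + N C suc m
    ≡⟨ +-comm (N C (2 + m)) (N C suc m) ⟩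
  N C suc m + N C (2 + m)
    ≡⟨ pascal N (suc m) ⟩
  suc N C (2 + m)
    ∎
  where
  pascal = nCk+nC[k+1]≡[n+1]C[k+1]
  N = r + (2 + m) * q + suc m
  regroup : ∀ a b q c₀ c₁ → a + b + q * (c₀ + c₁) ≡ (a + q * c₁) + (b + q * c₀)
  regroup = solve-∀
  top : ∀ r q m → r + suc q + suc m * q + m ≡ r + (2 + m) * q + suc m
  top = solve-∀
  shifted : raney (suc q) (r + suc q) (suc m) + q * (N C m) ≡ N C suc m
  shifted = subst (λ n → raney (suc q) (r + suc q) (suc m) + q * (n C m) ≡ n C suc m)
                  (top r q m) (raney-binomial q (r + suc q) m)

raney-closedForm : ∀ q j m → (suc j + m * q) * raney (suc q) (suc j) m ≡ suc j * ((j + m * q + m) C m)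
raney-closedForm q j zero    = cong (_* 1) (+-identityʳ (suc j))
raney-closedForm q j (suc m) = begin
  t * R          ≡⟨ +-cancelʳ-≡ (X * c₁) (t * R) (suc j * c₁) splitOff ⟩
  suc j * c₁     ≡⟨ cong (λ n → suc j * (n C suc m)) (+-suc (j + X) m) ⟨
  suc j * ((j + X + suc m) C suc m) ∎
  where
  X = suc m * q
  t = suc j + X
  R = raney (suc q) (suc j) (suc m)
  c₀ = (t + m) C m
  c₁ = (t + m) C suc m
  Xc₁≡t*qc₀ : X * c₁ ≡ t * (q * c₀)
  Xc₁≡t*qc₀ = begin
    suc m * q * c₁   ≡⟨ *-xy∙z≈y∙xz (suc m) q c₁ ⟩
    q * (suc m * c₁) ≡⟨ cong (q *_) ([k+1]*[n+k]C[k+1]≡n*[n+k]Ck t m) ⟩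
    q * (t * c₀)     ≡⟨ *-x∙yz≈y∙xz q t c₀ ⟩
    t * (q * c₀)     ∎
  splitOff : t * R + X * c₁ ≡ suc j * c₁ + X * c₁
  splitOff = begin
    t * R + X * c₁       ≡⟨ cong (t * R +_) Xc₁≡t*qc₀ ⟩
    t * R + t * (q * c₀) ≡⟨ *-distribˡ-+ t R (q * c₀) ⟨
    t * (R + q * c₀)     ≡⟨ cong (t *_) (raney-binomial q (suc j) m) ⟩
    t * c₁               ≡⟨ *-distribʳ-+ c₁ (suc j) X ⟩
    suc j * c₁ + X * c₁  ∎

lookup-hist : ∀ k n (i : Fin (suc n)) → lookup (hist k n) i ≡ a k (n ∸ toℕ i)
lookup-hist k zero    zero    = refl
lookup-hist k (suc n) zero    = refl
lookup-hist k (suc n) (suc i) = lookup-hist k n i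

sumFin≡sumTo : ∀ n {f : Fin (suc n) → ℕ} {g : ℕ → ℕ} → (∀ i → f i ≡ g (toℕ i)) → sumFin n f ≡ sumTo n g
sumFin≡sumTo zero    f≗g = f≗g zero
sumFin≡sumTo (suc n) f≗g = cong₂ _+_ (f≗g zero) (sumFin≡sumTo n (f≗g ∘ suc))

-- The summand of the recurrence in Defs is local to a where block and cannot be named;
-- the underscore in the type of a-summand is solved by its use in a-suc.
mutual
  a-suc : ∀ k n → a k (suc n) ≡ sumTo n (restrictToMultiples k (λ i → a k i * a k (n ∸ i)))
  a-suc k n = begin
    a k (suc n)
      ≡⟨ sumFin≡sumTo n (a-summand k n) ⟩
    sumTo n (λ i → restrictToMultiples k (λ i → a k i * a k (n ∸ i)) (n ∸ i))
      ≡⟨ sumTo-reverse n _ ⟨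
    sumTo n (restrictToMultiples k (λ i → a k i * a k (n ∸ i)))
      ∎

  a-summand : ∀ k n (i : Fin (suc n)) → _ ≡ restrictToMultiples k (λ i → a k i * a k (n ∸ i)) (n ∸ toℕ i)
  a-summand k n i with k ∣? (n ∸ toℕ i)
  ... | yes _ = cong₂ _*_ (lookup-hist k n i)
                         (trans (lookup-hist k n (opposite i)) (cong (λ l → a k (n ∸ l)) (opposite-prop i)))
  ... | no _  = refl

HasRaneyValue : ℕ → ℕ → Set
HasRaneyValue k n = ∀ m j → j < suc k → j + m * suc k ≡ n → a (suc k) n ≡ raney (2 + k) (suc j) m

a-suc≡raney : ∀ k m j → j < suc k → (∀ {n} → n ≤ j + m * suc k → HasRaneyValue k n) →
              a (suc k) (suc j + m * suc k) ≡ raney (2 + k) (2 + j) m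
a-suc≡raney k m j j<1+k below = begin
  a K (suc n)                                   ≡⟨ a-suc K n ⟩
  sumTo n (restrictToMultiples K h)             ≡⟨ sumTo-restrictToMultiples-offset k h m j j<1+k ⟩
  sumTo (m * K) (restrictToMultiples K h)       ≡⟨ sumTo-restrictToMultiples k h m ⟩
  sumTo m (λ l → a K (l * K) * a K (n ∸ l * K)) ≡⟨ sumTo-cong m factors ⟩
  (raney (2 + k) 1 ⊛ raney (2 + k) (suc j)) m   ≡⟨ raney-conv (2 + k) (suc j) m ⟩
  raney (2 + k) (2 + j) m                       ∎
  where
  K = suc k
  n = j + m * K
  h = λ i → a K i * a K (n ∸ i)
  factors : ∀ {l} → l ≤ m → a K (l * K) * a K (n ∸ l * K) ≡ raney (2 + k) 1 l * raney (2 + k) (suc j) (m ∸ l)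
  factors {l} l≤m = cong₂ _*_ (below lK≤n l 0 z<s refl) (below (m∸n≤m n (l * K)) (m ∸ l) j j<1+k remainder)
    where
    lK≤n : l * K ≤ n
    lK≤n = ≤-trans (*-monoˡ-≤ K l≤m) (m≤n+m (m * K) j)
    remainder : j + (m ∸ l) * K ≡ n ∸ l * K
    remainder = begin
      j + (m ∸ l) * K     ≡⟨ cong (j +_) (*-distribʳ-∸ K m l) ⟩
      j + (m * K ∸ l * K) ≡⟨ +-∸-assoc j (*-monoˡ-≤ K l≤m) ⟨
      n ∸ l * K           ∎

hasRaneyValue : ∀ k n → HasRaneyValue k n
hasRaneyValue k = <-rec (HasRaneyValue k) step
  where
  step : ∀ n → (∀ {n'} → n' < n → HasRaneyValue k n') → HasRaneyValue k n
  step _ _     zero    zero    _       refl = refl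
  step _ below m       (suc j) 1+j<1+k refl = a-suc≡raney k m j (<-trans (n<1+n j) 1+j<1+k) (below ∘ s≤s)
  step _ below (suc m) zero    _       refl = a-suc≡raney k m k ≤-refl (below ∘ s≤s)

mainTheorem3 : (k : ℕ) → .{{_ : NonZero k}} → (m j : ℕ) → j < k →
    (k * m + j + 1) * a k (k * m + j) ≡ (j + 1) * (((k + 1) * m + j) C (k * m + j))
mainTheorem3 (suc k) m j j<k = begin
  (suc k * m + j + 1) * a (suc k) (suc k * m + j)
    ≡⟨ cong₂ (λ t n → t * a (suc k) n) (factor k m j) (index k m j) ⟩
  (suc j + m * suc k) * a (suc k) (j + m * suc k)
    ≡⟨ cong ((suc j + m * suc k) *_) (hasRaneyValue k _ m j j<k refl) ⟩
  (suc j + m * suc k) * raney (2 + k) (suc j) m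
    ≡⟨ raney-closedForm (suc k) j m ⟩
  suc j * ((j + m * suc k + m) C m)
    ≡⟨ cong (suc j *_) ([m+n]Cn≡[m+n]Cm (j + m * suc k) m) ⟩
  suc j * ((j + m * suc k + m) C (j + m * suc k))
    ≡⟨ cong₂ _*_ (+-comm j 1) (cong₂ _C_ (top k m j) (index k m j)) ⟨
  (j + 1) * (((suc k + 1) * m + j) C (suc k * m + j))
    ∎
  where
  factor : ∀ k m j → suc k * m + j + 1 ≡ suc j + m * suc k
  factor = solve-∀
  index : ∀ k m j → suc k * m + j ≡ j + m * suc k
  index = solve-∀
  top : ∀ k m j → (suc k + 1) * m + j ≡ j + m * suc k + m
  top = solve-∀
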